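{- Let $A=(a_{pqr})_{p,q,r\in\{0,1\}}$ be a Bhargava cube all of whose entries are positive integers. Then all six $2\times2$ cross sections of $A$ have determinant $1$ if and only if $A=A_n$ for some integer $n$, where $A_n$ is the cube with entries $(A_n)_{pqr}=F_{2(n+p+q+r)-3}$, i.e.\ $(A_n)_{000}=F_{2n-3}$, $(A_n)_{100}=(A_n)_{010}=(A_n)_{001}=F_{2n-1}$, $(A_n)_{110}=(A_n)_{101}=(A_n)_{011}=F_{2n+1}$, $(A_n)_{111}=F_{2n+3}$.
   Context: $(F_m)_{m\in\mathbb{Z}}$ are the Fibonacci numbers: $F_0=0$, $F_1=1$, $F_{m+1}=F_m+F_{m-1}$ for all $m\in\mathbb{Z}$. A Bhargava cube is an integer array $(a_{pqr})_{p,q,r\in\{0,1\}}$. Its six $2\times2$ cross sections are the matrices obtained by fixing one index: for fixed $p$, $(a_{pqr})_{q,r}$ (rows indexed by $q$, columns by $r$); for fixed $q$, $(a_{pqr})_{p,r}$ (rows $p$, columns $r$); for fixed $r$, $(a_{pqr})_{p,q}$ (rows $p$, columns $q$). -}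

module Defs where

open import Data.Bool using (Bool; true; false)
open import Data.Nat using (ℕ; zero; suc)
open import Data.Integer using (ℤ; +_; -[1+_]; _+_; _-_; _*_; -_; _<_)
open import Data.Product using (_×_)
open import Relation.Binary.PropositionalEquality using (_≡_)

fibℕ : ℕ → ℤ
fibℕ zero = + 0
fibℕ (suc zero) = + 1
fibℕ (suc (suc n)) = fibℕ (suc n) + fibℕ n

-- Fibonacci numbers on ℤ: the unique extension satisfying F(m+1)=F(m)+F(m-1)
-- for all integers m, namely F(-k) = (-1)^(k+1) F(k).
fib : ℤ → ℤ
fib (+ n) = fibℕ n
fib -[1+ k ] = sign k (fibℕ (suc k))
  where
  sign : ℕ → ℤ → ℤ
  sign zero x = x
  sign (suc j) x = - sign j x

-- A Bhargava cube: entries a p q r, with indices in {0,1} encoded as Bool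
-- (false = 0, true = 1).
Cube : Set
Cube = Bool → Bool → Bool → ℤ

bit : Bool → ℤ
bit false = + 0
bit true = + 1

det2 : ℤ → ℤ → ℤ → ℤ → ℤ
det2 a b c d = a * d - b * c

det : (Bool → Bool → ℤ) → ℤ
det M = det2 (M false false) (M false true) (M true false) (M true true)

sectionP : Cube → Bool → (Bool → Bool → ℤ)
sectionP A p q r = A p q r

sectionQ : Cube → Bool → (Bool → Bool → ℤ)
sectionQ A q p r = A p q r

sectionR : Cube → Bool → (Bool → Bool → ℤ)
sectionR A r p q = A p q r

AllSectionsDetOne : Cube → Set
AllSectionsDetOne A =
  ((p : Bool) → det (sectionP A p) ≡ + 1) ×
  ((q : Bool) → det (sectionQ A q) ≡ + 1) ×
  ((r : Bool) → det (sectionR A r) ≡ + 1)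

AllPositive : Cube → Set
AllPositive A = (p q r : Bool) → + 0 < A p q r

cubeA : ℤ → Cube
cubeA n p q r = fib ((+ 2) * (n + bit p + bit q + bit r) - + 3)

{-# OPTIONS --safe #-}
module Submission where

-- Write a, b, c, d, e, f, g, h for a₀₀₀, a₁₀₀, a₀₁₀, a₀₀₁, a₁₁₀, a₁₀₁, a₀₁₁, a₁₁₁. The polynomial identity
-- a c (bh − fe) + e c (af − db) = e b (ag − dc) + a b (ch − ge) among four section determinants turns into
-- (a + e) c = (a + e) b when they are all 1, so c = b; likewise d = b, and then e = f = g. Hence the entries
-- depend only on p + q + r, as x₀, x₁, x₂, x₃ with x₀x₂ − x₁² = x₁x₃ − x₂² = 1.
-- If 0 < x₁ < x₂ then x₀x₂ = 1 + x₁² ≤ x₁x₂ gives 0 < x₀ ≤ x₁, and the chain extends to the left by a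
-- term that is a polynomial in x₀, …, x₃; symmetrically when x₂ < x₁. This descent on x₁ + x₂ stops at
-- x₁ = x₂ = 1, so the chain consists of consecutive terms of uⱼ = F₂ⱼ₋₃, whose Hankel determinants
-- uⱼuⱼ₊₂ − uⱼ₊₁² are all 1 because uⱼ₊₂ = 3uⱼ₊₁ − uⱼ.

open import Defs
open import Data.Integer using (ℤ)
open import Data.Product using (∃)
open import Function.Bundles using (_⇔_)
open import Relation.Binary.PropositionalEquality using (_≡_)

open import Data.Bool using (Bool; true; false)
open import Data.Empty using (⊥-elim)
open import Data.Integer
  using (+_; -[1+_]; _+_; _-_; _*_; -_; _<_; _≤_; +<+; +≤+; ∣_∣; nonNegative; positive; >-nonZero)
  renaming (suc to sucℤ)
open import Data.Integer.Properties
open import Algebra.Properties.AbelianGroup +-0-abelianGroup using (∙-cancelʳ)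
open import Data.Integer.Tactic.RingSolver using (solve-∀; solve)
open import Data.List using (_∷_; [])
open import Data.Nat using (ℕ; zero; suc; z≤n; s≤s)
import Data.Nat.Properties as ℕ
open import Data.Product using (_×_; _,_)
open import Function.Bundles using (mk⇔)
open import Relation.Binary.Definitions using (tri<; tri≈; tri>)
open import Relation.Binary.PropositionalEquality
  using (refl; sym; trans; cong; cong₂; subst; subst₂; module ≡-Reasoning)

mutual
  -- Defs.fib multiplies by (−1)ʲ through a where-bound helper; solving this metavariable by unification
  -- names that helper. Its first argument is the clause variable of fib, on which it does not depend.
  negⁿ : ℕ → ℕ → ℤ → ℤ
  negⁿ = _

  fib-negsuc-suc : ∀ k → fib -[1+ suc k ] ≡ - negⁿ (suc k) k (fibℕ (suc (suc k)))
  fib-negsuc-suc k with suc k | fibℕ (suc (suc k))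
  ... | _ | _ = refl

negⁿ-irrelevant : ∀ p q j x → negⁿ p j x ≡ negⁿ q j x
negⁿ-irrelevant p q zero    x = refl
negⁿ-irrelevant p q (suc j) x = cong -_ (negⁿ-irrelevant p q j x)

negⁿ-+ : ∀ p j x y → negⁿ p j (x + y) ≡ negⁿ p j x + negⁿ p j y
negⁿ-+ p zero    x y = refl
negⁿ-+ p (suc j) x y = trans (cong -_ (negⁿ-+ p j x y)) (neg-distrib-+ (negⁿ p j x) (negⁿ p j y))

fib-negsuc : ∀ k → fib -[1+ k ] ≡ negⁿ 0 k (fibℕ (suc k))
fib-negsuc zero    = refl
fib-negsuc (suc k) = trans (fib-negsuc-suc k) (cong -_ (negⁿ-irrelevant (suc k) 0 k _))

neg-+-cancelˡ : ∀ s t → t ≡ - s + (s + t)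
neg-+-cancelˡ = solve-∀

fib-rec : ∀ m → fib (sucℤ (sucℤ m)) ≡ fib (sucℤ m) + fib m
fib-rec (+ n)              = refl
fib-rec -[1+ 0 ]           = refl
fib-rec -[1+ 1 ]           = refl
fib-rec -[1+ suc (suc k) ] = begin
  fib -[1+ k ]                              ≡⟨ fib-negsuc k ⟩
  σ a                                       ≡⟨ neg-+-cancelˡ (σ b) (σ a) ⟩
  - σ b + (σ b + σ a)                       ≡⟨ cong (_+_ (- σ b)) (negⁿ-+ 0 k b a) ⟨
  - σ b + σ (b + a)                         ≡⟨ cong (_+_ (- σ b)) (neg-involutive _) ⟨
  - σ b + - - σ (b + a)                     ≡⟨ cong₂ _+_ (fib-negsuc (suc k)) (fib-negsuc (suc (suc k))) ⟨
  fib -[1+ suc k ] + fib -[1+ suc (suc k) ] ∎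
  where
  open ≡-Reasoning
  σ : ℤ → ℤ
  σ = negⁿ 0 k
  a b : ℤ
  a = fibℕ (suc k)
  b = fibℕ (suc (suc k))

fib-rec-by-two : ∀ m → fib (sucℤ (sucℤ (sucℤ (sucℤ m)))) ≡ + 3 * fib (sucℤ (sucℤ m)) - fib m
fib-rec-by-two m = begin
  fib (sucℤ (sucℤ (sucℤ (sucℤ m))))    ≡⟨ fib-rec (sucℤ (sucℤ m)) ⟩
  fib (sucℤ (sucℤ (sucℤ m))) + F₂      ≡⟨ cong (_+ F₂) (fib-rec (sucℤ m)) ⟩
  F₂ + F₁ + F₂                         ≡⟨ cong (λ t → t + F₁ + t) (fib-rec m) ⟩
  (F₁ + F₀) + F₁ + (F₁ + F₀)           ≡⟨ identity F₁ F₀ ⟩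
  + 3 * (F₁ + F₀) - F₀                 ≡⟨ cong (λ t → + 3 * t - F₀) (fib-rec m) ⟨
  + 3 * F₂ - F₀                        ∎
  where
  open ≡-Reasoning
  F₀ F₁ F₂ : ℤ
  F₀ = fib m
  F₁ = fib (sucℤ m)
  F₂ = fib (sucℤ (sucℤ m))
  identity : ∀ x y → (x + y) + x + (x + y) ≡ + 3 * (x + y) - y
  identity = solve-∀

oddFib : ℤ → ℤ
oddFib j = fib (+ 2 * j - + 3)

oddFib-index-suc : ∀ j → + 2 * (j + + 1) - + 3 ≡ + 1 + (+ 1 + (+ 2 * j - + 3))
oddFib-index-suc = solve-∀

oddFib-rec : ∀ j → oddFib (j + + 1 + + 1) ≡ + 3 * oddFib (j + + 1) - oddFib j
oddFib-rec j = begin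
  fib (+ 2 * (j + + 1 + + 1) - + 3)          ≡⟨ cong fib (oddFib-index-suc (j + + 1)) ⟩
  fib (sucℤ (sucℤ (+ 2 * (j + + 1) - + 3))) ≡⟨ cong (λ i → fib (sucℤ (sucℤ i))) (oddFib-index-suc j) ⟩
  fib (sucℤ (sucℤ (sucℤ (sucℤ m))))        ≡⟨ fib-rec-by-two m ⟩
  + 3 * fib (sucℤ (sucℤ m)) - fib m        ≡⟨ cong (λ i → + 3 * fib i - fib m) (oddFib-index-suc j) ⟨
  + 3 * oddFib (j + + 1) - oddFib j        ∎
  where
  open ≡-Reasoning
  m : ℤ
  m = + 2 * j - + 3

recurrence-preserves-hankel-det : ∀ k x y →
  y * (k * (k * y - x) - y) - (k * y - x) * (k * y - x) ≡ x * (k * y - x) - y * y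
recurrence-preserves-hankel-det = solve-∀

shift-invariant⇒constant : ∀ {A : Set} (f : ℤ → A) → (∀ j → f (j + + 1) ≡ f j) → ∀ j → f j ≡ f (+ 0)
shift-invariant⇒constant f step (+ zero)     = refl
shift-invariant⇒constant f step (+ suc n)    = begin
  f (+ suc n)   ≡⟨ cong (λ i → f (+ i)) (ℕ.+-comm n 1) ⟨
  f (+ n + + 1) ≡⟨ step (+ n) ⟩
  f (+ n)       ≡⟨ shift-invariant⇒constant f step (+ n) ⟩
  f (+ 0)       ∎
  where open ≡-Reasoning
shift-invariant⇒constant f step -[1+ zero ]  = sym (step -[1+ zero ])
shift-invariant⇒constant f step -[1+ suc n ] =
  trans (sym (step -[1+ suc n ])) (shift-invariant⇒constant f step -[1+ n ])

record HankelDetOne (x y z : ℤ) : Set where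
  constructor hankel
  field det≡1 : det2 x y y z ≡ + 1

oddFib-hankel : ∀ j → HankelDetOne (oddFib j) (oddFib (j + + 1)) (oddFib (j + + 1 + + 1))
oddFib-hankel j = hankel (shift-invariant⇒constant D step j)
  where
  D : ℤ → ℤ
  D j = det2 (oddFib j) (oddFib (j + + 1)) (oddFib (j + + 1)) (oddFib (j + + 1 + + 1))
  step : ∀ j → D (j + + 1) ≡ D j
  step j = begin
    det2 y z z (oddFib (j + + 1 + + 1 + + 1)) ≡⟨ cong (det2 y z z) (oddFib-rec (j + + 1)) ⟩
    det2 y z z (+ 3 * z - y)                  ≡⟨ cong (λ t → det2 y t t (+ 3 * t - y)) (oddFib-rec j) ⟩
    det2 y z′ z′ (+ 3 * z′ - y)               ≡⟨ recurrence-preserves-hankel-det (+ 3) x y ⟩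
    det2 x y y z′                              ≡⟨ cong (det2 x y y) (oddFib-rec j) ⟨
    D j                                        ∎
    where
    open ≡-Reasoning
    x y z z′ : ℤ
    x = oddFib j
    y = oddFib (j + + 1)
    z = oddFib (j + + 1 + + 1)
    z′ = + 3 * y - x

hankel-reverse : ∀ {x y z} → HankelDetOne x y z → HankelDetOne z y x
hankel-reverse {x} {y} {z} (hankel xyz) = hankel (trans (cong (_- y * y) (*-comm z x)) xyz)

hankel-product : ∀ {x y z} → HankelDetOne x y z → x * z ≡ + 1 + y * y
hankel-product {x} {y} {z} (hankel xyz) = begin
  x * z                  ≡⟨ solve (x ∷ y ∷ z ∷ []) ⟩
  x * z - y * y + y * y  ≡⟨ cong (_+ y * y) xyz ⟩
  + 1 + y * y            ∎
  where open ≡-Reasoning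

square-nonNeg : ∀ i → + 0 ≤ i * i
square-nonNeg (+ n)    = subst (+ 0 ≤_) (pos-* n n) (+≤+ z≤n)
square-nonNeg -[1+ n ] = +≤+ z≤n

hankel-left-pos : ∀ {x y z} → + 0 < z → HankelDetOne x y z → + 0 < x
hankel-left-pos {x} {y} {z} z>0 xyz = *-cancelʳ-<-nonNeg z {{nonNegative (<⇒≤ z>0)}} (begin-strict
  + 0 * z     ≡⟨ *-zeroˡ z ⟩
  + 0         <⟨ +-mono-<-≤ (+<+ (s≤s z≤n)) (square-nonNeg y) ⟩
  + 1 + y * y ≡⟨ hankel-product xyz ⟨
  x * z       ∎)
  where open ≤-Reasoning

hankel-left-le : ∀ {x y z} → + 0 < y → y < z → HankelDetOne x y z → x ≤ y
hankel-left-le {x} {y} {z} y>0 y<z xyz = *-cancelʳ-≤-pos x y z {{positive (<-trans y>0 y<z)}} (begin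
  x * z          ≡⟨ hankel-product xyz ⟩
  + 1 + y * y    ≤⟨ +-monoˡ-≤ (y * y) (i<j⇒suc[i]≤j y>0) ⟩
  y + y * y      ≡⟨ solve (y ∷ []) ⟩
  y * (+ 1 + y)  ≤⟨ *-monoˡ-≤-nonNeg y {{nonNegative (<⇒≤ y>0)}} (i<j⇒suc[i]≤j y<z) ⟩
  y * z          ∎)
  where open ≤-Reasoning

hankel-diagonal : ∀ {x z} → + 0 < x → HankelDetOne x x z → x ≡ + 1
hankel-diagonal {x} {z} x>0 (hankel xxz) = begin
  x        ≡⟨ 0≤i⇒+∣i∣≡i (<⇒≤ x>0) ⟨
  + ∣ x ∣  ≡⟨ cong +_ (ℕ.m*n≡1⇒m≡1 ∣ x ∣ ∣ z - x ∣ (trans (sym (abs-* x (z - x))) (cong ∣_∣ x[z-x]≡1))) ⟩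
  + 1      ∎
  where
  open ≡-Reasoning
  x[z-x]≡1 : x * (z - x) ≡ + 1
  x[z-x]≡1 = begin
    x * (z - x)    ≡⟨ solve (x ∷ z ∷ []) ⟩
    x * z - x * x  ≡⟨ xxz ⟩
    + 1            ∎

hankel-unique-right : ∀ {x y z z′} → + 0 < x → HankelDetOne x y z → HankelDetOne x y z′ → z ≡ z′
hankel-unique-right {x} {y} {z} {z′} x>0 (hankel xyz) (hankel xyz′) =
  *-cancelˡ-≡ x z z′ {{>-nonZero x>0}} (∙-cancelʳ (- (y * y)) (x * z) (x * z′) (trans xyz (sym xyz′)))

hankel-unique-left : ∀ {x x′ y z} → + 0 < z → HankelDetOne x y z → HankelDetOne x′ y z → x ≡ x′
hankel-unique-left z>0 xyz x′yz = hankel-unique-right z>0 (hankel-reverse xyz) (hankel-reverse x′yz)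

-- The new first term is (1 + w²) / x, written as a polynomial by means of x z = 1 + y² and w y = 1 + x².
hankel-extendˡ : ∀ {w x y z} → HankelDetOne w x y → HankelDetOne x y z →
  HankelDetOne (z * w * w - + 2 * x - x * x * x) w x
hankel-extendˡ {w} {x} {y} {z} wxy xyz = hankel (begin
  (z * w * w - + 2 * x - x * x * x) * x - w * w
    ≡⟨ solve (w ∷ x ∷ z ∷ []) ⟩
  w * w * (x * z) - w * w - + 2 * x * x - x * x * x * x
    ≡⟨ cong (λ t → w * w * t - w * w - + 2 * x * x - x * x * x * x) (hankel-product xyz) ⟩
  w * w * (+ 1 + y * y) - w * w - + 2 * x * x - x * x * x * x
    ≡⟨ solve (w ∷ x ∷ y ∷ []) ⟩
  (w * y) * (w * y) - + 2 * x * x - x * x * x * x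
    ≡⟨ cong (λ t → t * t - + 2 * x * x - x * x * x * x) (hankel-product wxy) ⟩
  (+ 1 + x * x) * (+ 1 + x * x) - + 2 * x * x - x * x * x * x
    ≡⟨ solve (x ∷ []) ⟩
  + 1 ∎)
  where open ≡-Reasoning

hankel-extendʳ : ∀ {w x y z} → HankelDetOne w x y → HankelDetOne x y z →
  HankelDetOne y z (w * z * z - + 2 * y - y * y * y)
hankel-extendʳ wxy xyz = hankel-reverse (hankel-extendˡ (hankel-reverse xyz) (hankel-reverse wxy))

hankel-next-oddFib : ∀ j {x y z} → + 0 < x → x ≡ oddFib j → y ≡ oddFib (j + + 1) →
  HankelDetOne x y z → z ≡ oddFib (j + + 1 + + 1)
hankel-next-oddFib j x>0 refl refl xyz = hankel-unique-right x>0 xyz (oddFib-hankel j)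

hankel-prev-oddFib : ∀ j {x y z} → + 0 < z → y ≡ oddFib (j + + 1) → z ≡ oddFib (j + + 1 + + 1) →
  HankelDetOne x y z → x ≡ oddFib j
hankel-prev-oddFib j z>0 refl refl xyz = hankel-unique-left z>0 xyz (oddFib-hankel j)

i<j≤1+n⇒i≤n : ∀ {i j n} → i < j → j ≤ + suc n → i ≤ + n
i<j≤1+n⇒i≤n i<j j≤1+n = i<j⇒i≤pred[j] (<-≤-trans i<j j≤1+n)

i-1+1≡i : ∀ i → i - + 1 + + 1 ≡ i
i-1+1≡i = solve-∀

positive-hankel-pair : ∀ (N : ℕ) {w x y z} → x + y ≤ + N → + 0 < x → + 0 < y →
  HankelDetOne w x y → HankelDetOne x y z → ∃ λ n → x ≡ oddFib (n + + 1) × y ≡ oddFib (n + + 1 + + 1)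
positive-hankel-pair zero x+y≤0 x>0 y>0 _ _ = ⊥-elim (<⇒≱ (+-mono-< x>0 y>0) x+y≤0)
positive-hankel-pair (suc N) {w} {x} {y} {z} x+y≤ x>0 y>0 wxy xyz with <-cmp x y
... | tri≈ _ refl _ = + 0 , x≡1 , x≡1
  where
  x≡1 : x ≡ + 1
  x≡1 = hankel-diagonal x>0 xyz
... | tri< x<y _ _ =
  let m , w≡ , x≡ = positive-hankel-pair N (i<j≤1+n⇒i≤n (+-mono-≤-< w≤x x<y) x+y≤) w>0 x>0
                      (hankel-extendˡ wxy xyz) wxy
  in m + + 1 , x≡ , hankel-next-oddFib (m + + 1) w>0 w≡ x≡ wxy
  where
  w>0 : + 0 < w
  w>0 = hankel-left-pos y>0 wxy
  w≤x : w ≤ x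
  w≤x = hankel-left-le x>0 x<y wxy
... | tri> _ _ y<x =
  let m , y≡ , z≡ = positive-hankel-pair N (i<j≤1+n⇒i≤n (+-mono-<-≤ y<x z≤y) x+y≤) y>0 z>0
                      xyz (hankel-extendʳ wxy xyz)
  in m - + 1 , subst (λ i → x ≡ oddFib i × y ≡ oddFib (i + + 1)) (sym (i-1+1≡i m))
                     (hankel-prev-oddFib m z>0 y≡ z≡ xyz , y≡)
  where
  z>0 : + 0 < z
  z>0 = hankel-left-pos x>0 (hankel-reverse xyz)
  z≤y : z ≤ y
  z≤y = hankel-left-le y>0 y<x (hankel-reverse xyz)

positive-hankel-chain : ∀ {w x y z} → + 0 < x → + 0 < y → HankelDetOne w x y → HankelDetOne x y z →
  ∃ λ n → w ≡ oddFib n × x ≡ oddFib (n + + 1) × y ≡ oddFib (n + + 1 + + 1) × z ≡ oddFib (n + + 1 + + 1 + + 1)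
positive-hankel-chain {x = x} {y} x>0 y>0 wxy xyz =
  let n , x≡ , y≡ = positive-hankel-pair ∣ x + y ∣ x+y≤∣x+y∣ x>0 y>0 wxy xyz
  in n , hankel-prev-oddFib n y>0 x≡ y≡ wxy , x≡ , y≡ , hankel-next-oddFib (n + + 1) x>0 x≡ y≡ xyz
  where
  x+y≤∣x+y∣ : x + y ≤ + ∣ x + y ∣
  x+y≤∣x+y∣ = ≤-reflexive (sym (0≤i⇒+∣i∣≡i (<⇒≤ (+-mono-< x>0 y>0))))

-- Unlike i + bit p, i +ᵇ p reduces to i or i + + 1 once p is known, so the sections of oddFibCube n
-- are definitionally the matrices of oddFib-hankel.
infixl 6 _+ᵇ_

_+ᵇ_ : ℤ → Bool → ℤ
i +ᵇ false = i
i +ᵇ true  = i + + 1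

+-bit : ∀ i p → i + bit p ≡ i +ᵇ p
+-bit i false = +-identityʳ i
+-bit i true  = refl

oddFibCube : ℤ → Cube
oddFibCube n p q r = oddFib (n +ᵇ p +ᵇ q +ᵇ r)

cubeA≗oddFibCube : ∀ n p q r → cubeA n p q r ≡ oddFibCube n p q r
cubeA≗oddFibCube n p q r = cong oddFib (begin
  n + bit p + bit q + bit r  ≡⟨ cong (λ i → i + bit q + bit r) (+-bit n p) ⟩
  n +ᵇ p + bit q + bit r     ≡⟨ cong (_+ bit r) (+-bit (n +ᵇ p) q) ⟩
  n +ᵇ p +ᵇ q + bit r        ≡⟨ +-bit (n +ᵇ p +ᵇ q) r ⟩
  n +ᵇ p +ᵇ q +ᵇ r           ∎)
  where open ≡-Reasoning

oddFibCube-sections : ∀ n → AllSectionsDetOne (oddFibCube n)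
oddFibCube-sections n =
  sectionAt , (λ { false → sectionAt false ; true → sectionAt true })
            , (λ { false → sectionAt false ; true → sectionAt true })
  where
  sectionAt : ∀ b →
    det2 (oddFib (n +ᵇ b)) (oddFib (n +ᵇ b + + 1)) (oddFib (n +ᵇ b + + 1)) (oddFib (n +ᵇ b + + 1 + + 1)) ≡ + 1
  sectionAt b = HankelDetOne.det≡1 (oddFib-hankel (n +ᵇ b))

det-cong : ∀ {M N : Bool → Bool → ℤ} → (∀ i j → M i j ≡ N i j) → det M ≡ det N
det-cong M≗N =
  cong₂ _-_ (cong₂ _*_ (M≗N false false) (M≗N true true)) (cong₂ _*_ (M≗N false true) (M≗N true false))

sections-cong : ∀ {A B : Cube} → (∀ p q r → A p q r ≡ B p q r) → AllSectionsDetOne B → AllSectionsDetOne A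
sections-cong A≗B (dP , dQ , dR) =
  (λ p → trans (det-cong (λ q r → A≗B p q r)) (dP p)) ,
  (λ q → trans (det-cong (λ p r → A≗B p q r)) (dQ q)) ,
  (λ r → trans (det-cong (λ p q → A≗B p q r)) (dR r))

det2-transpose : ∀ a b c d → det2 a b c d ≡ det2 a c b d
det2-transpose a b c d = cong (_-_ (a * d)) (*-comm b c)

section-syzygy : ∀ a b c d e f g h →
  a * c * (b * h - f * e) + e * c * (a * f - d * b) ≡ e * b * (a * g - d * c) + a * b * (c * h - g * e)
section-syzygy = solve-∀

edge-equality : ∀ a b c d e f g h → + 0 < a + e →
  det2 a d c g ≡ + 1 → det2 b f e h ≡ + 1 → det2 a d b f ≡ + 1 → det2 c g e h ≡ + 1 → c ≡ b
edge-equality a b c d e f g h a+e>0 P₀ P₁ Q₀ Q₁ =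
  *-cancelˡ-≡ (a + e) c b {{>-nonZero a+e>0}} (begin
    (a + e) * c                                  ≡⟨ solve (a ∷ c ∷ e ∷ []) ⟩
    a * c * + 1 + e * c * + 1                    ≡⟨ cong₂ (λ s t → a * c * s + e * c * t) P₁ Q₀ ⟨
    a * c * det2 b f e h + e * c * det2 a d b f  ≡⟨ section-syzygy a b c d e f g h ⟩
    e * b * det2 a d c g + a * b * det2 c g e h  ≡⟨ cong₂ (λ s t → e * b * s + a * b * t) P₀ Q₁ ⟩
    e * b * + 1 + a * b * + 1                    ≡⟨ solve (a ∷ b ∷ e ∷ []) ⟩
    (a + e) * b                                  ∎)
  where open ≡-Reasoning

unimodular-cube-oddFib : (A : Cube) → AllPositive A → AllSectionsDetOne A →
  ∃ λ n → ∀ p q r → A p q r ≡ oddFibCube n p q r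
unimodular-cube-oddFib A pos (dP , dQ , dR) =
  let n , a≡ , b≡ , e≡ , h≡ = positive-hankel-chain (pos true false false) (pos true true false) abe beh
  in n , λ { false false false → a≡
           ; true  false false → b≡ ; false true  false → trans c≡b b≡ ; false false true → trans d≡b b≡
           ; true  true  false → e≡ ; true  false true  → trans f≡e e≡ ; false true  true → trans g≡e e≡
           ; true  true  true  → h≡ }
  where
  a b c d e f g h : ℤ
  a = A false false false
  b = A true  false false
  c = A false true  false
  d = A false false true
  e = A true  true  false
  f = A true  false true
  g = A false true  true
  h = A true  true  true
  c≡b : c ≡ b
  c≡b = edge-equality a b c d e f g h (+-mono-< (pos false false false) (pos true true false))
    (dP false) (dP true) (dQ false) (dQ true)
  d≡b : d ≡ b
  d≡b = edge-equality a b d c f e g h (+-mono-< (pos false false false) (pos true false true))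
    (trans (det2-transpose a c d g) (dP false)) (trans (det2-transpose b e f h) (dP true)) (dR false) (dR true)
  abe : HankelDetOne a b e
  abe = hankel (subst (λ t → det2 a t b e ≡ + 1) c≡b (dR false))
  f≡e : f ≡ e
  f≡e = hankel-unique-right (pos false false false)
    (hankel (subst (λ t → det2 a t b f ≡ + 1) d≡b (dQ false))) abe
  g≡e : g ≡ e
  g≡e = hankel-unique-right (pos false false false)
    (hankel (subst₂ (λ s t → det2 a s t g ≡ + 1) d≡b c≡b (dP false))) abe
  beh : HankelDetOne b e h
  beh = hankel (subst (λ t → det2 b t e h ≡ + 1) f≡e (dP true))

theorem10p2 : (A : Cube) → AllPositive A →
    (AllSectionsDetOne A ⇔ ∃ λ (n : ℤ) → (p q r : _) → A p q r ≡ cubeA n p q r)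
theorem10p2 A pos = mk⇔ forward backward
  where
  forward : AllSectionsDetOne A → ∃ λ n → ∀ p q r → A p q r ≡ cubeA n p q r
  forward sections =
    let n , A≗ = unimodular-cube-oddFib A pos sections
    in n , λ p q r → trans (A≗ p q r) (sym (cubeA≗oddFibCube n p q r))
  backward : (∃ λ n → ∀ p q r → A p q r ≡ cubeA n p q r) → AllSectionsDetOne A
  backward (n , A≗) =
    sections-cong (λ p q r → trans (A≗ p q r) (cubeA≗oddFibCube n p q r)) (oddFibCube-sections n)
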